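{- Let $G$ be a graph having three or four components. Then $G$ is niche-realizable if and only if each of its components is complete.
   Context: All graphs are simple. A bipartite tournament is an orientation of a complete bipartite graph. The niche graph of a digraph $D$ is the graph with vertex set $V(D)$ in which distinct $u,v$ are adjacent iff there is a vertex $w$ with $(u,w),(v,w)\in A(D)$, or with $(w,u),(w,v)\in A(D)$. A graph is niche-realizable if it is the niche graph of some bipartite tournament. -}

module Defs where

open import Data.Nat using (ℕ)
open import Data.Fin using (Fin)
open import Data.Bool using (Bool; true; false; _≟_)
open import Data.Product using (Σ; _×_; ∃-syntax)
open import Data.Sum using (_⊎_)
open import Relation.Binary.PropositionalEquality using (_≡_; _≢_)
open import Relation.Nullary using (¬_)
open import Function.Bundles using (_⇔_)
open import Function.Definitions using (Surjective)

record Graph (n : ℕ) : Set where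
  field
    adj   : Fin n → Fin n → Bool
    sym   : ∀ u v → adj u v ≡ adj v u
    irrfl : ∀ u → adj u u ≡ false
open Graph public

-- A bipartite tournament on vertex set Fin n: a bipartition (part) of the
-- vertices into two sets, and an orientation (arc u v = true means (u,v) is
-- an arc) of the complete bipartite graph between the two parts:
-- no arcs inside a part, and exactly one arc between any two vertices of
-- different parts.
record BipartiteTournament (n : ℕ) : Set where
  field
    part      : Fin n → Bool
    arc       : Fin n → Fin n → Bool
    inside    : ∀ u v → part u ≡ part v → arc u v ≡ false
    across    : ∀ u v → part u ≢ part v → (arc u v ≡ true) ⊎ (arc v u ≡ true)
    asym      : ∀ u v → ¬ (arc u v ≡ true × arc v u ≡ true)
open BipartiteTournament public

NicheAdj : ∀ {n} → BipartiteTournament n → Fin n → Fin n → Set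
NicheAdj D u v =
  u ≢ v ×
  ∃[ w ] ((arc D u w ≡ true × arc D v w ≡ true)
          ⊎ (arc D w u ≡ true × arc D w v ≡ true))

IsNicheGraphOf : ∀ {n} → Graph n → BipartiteTournament n → Set
IsNicheGraphOf G D = ∀ u v → (adj G u v ≡ true) ⇔ NicheAdj D u v

NicheRealizable : ∀ {n} → Graph n → Set
NicheRealizable {n} G = ∃[ D ] IsNicheGraphOf G D

data Connected {n : ℕ} (G : Graph n) : Fin n → Fin n → Set where
  here : ∀ {u} → Connected G u u
  step : ∀ {u v w} → adj G u v ≡ true → Connected G v w → Connected G u w

-- G has exactly k components: there is a surjective labelling of the
-- vertices by Fin k whose fibres are exactly the connected components.
HasComponents : ∀ {n} → Graph n → ℕ → Set
HasComponents {n} G k =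
  Σ (Fin n → Fin k) λ c →
    Surjective _≡_ _≡_ c × (∀ u v → (c u ≡ c v) ⇔ Connected G u v)

ComponentsComplete : ∀ {n} → Graph n → Set
ComponentsComplete G = ∀ u v → u ≢ v → Connected G u v → adj G u v ≡ true

module Submission where

-- Niche edges stay inside a part, so every component lies in one part. Let u ≠ v be
-- non-adjacent vertices of one component, in the part X, and let w lie in the other part Y.
-- Since u and v disagree on the direction of their arc to w, every x ∈ X agrees with one of
-- them, so X is a single component. If p, q ∈ Y were in different components, every x ∈ X
-- would have an arc into exactly one of p, q; two niche-adjacent x, x′ making different
-- choices would have a common neighbour niche-adjacent to both p and q. So the choice is
-- constant on the component of u, and u, v share an arc to p: a contradiction. Hence a niche
-- graph with an incomplete component has at most two components.
-- Conversely, disjoint cliques labelled by Fin 4 are the niche graph of the pullback of the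
-- cyclically oriented 4-cycle 0 → 1 → 2 → 3 → 0 along the labelling, as soon as the labels
-- 1 and 2 are used: each label then has a common in- or out-neighbour label.

open import Data.Bool using (Bool; true; false; not)
import Data.Bool as Bool
open import Data.Bool.Properties using (¬-not)
open import Data.Empty using (⊥-elim)
open import Data.Fin using (Fin; inject₁; _≟_)
open import Data.Fin.Patterns using (0F; 1F; 2F; 3F)
open import Data.Fin.Properties using (pigeonhole; <⇒≢; inject₁-injective; 2↔Bool)
open import Data.Nat using (ℕ)
open import Data.Nat.Properties using (n<1+n)
open import Data.Product using (_×_; _,_; proj₁; proj₂; ∃-syntax; ∃₂)
open import Data.Sum using (_⊎_; inj₁; inj₂)
import Data.Sum as Sum
open import Function using (_∘_)
open import Function.Bundles using (_⇔_; mk⇔; Equivalence; Inverse)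
open import Relation.Binary.PropositionalEquality
open import Relation.Nullary using (¬_; yes; no; does)
open import Relation.Nullary.Decidable using (dec-true; dec-false)

open import Defs hiding (sym)

open Equivalence

private variable
  n m : ℕ
  u v w x y p q : Fin n

both≢⇒≡ : {a b c : Bool} → a ≢ c → b ≢ c → a ≡ b
both≢⇒≡ a≢c b≢c = trans (¬-not a≢c) (sym (¬-not b≢c))

bool-pigeonhole : (f : Fin 3 → Bool) → ∃₂ λ i j → i ≢ j × f i ≡ f j
bool-pigeonhole f with i , j , i<j , same ← pigeonhole (n<1+n 2) (Inverse.from 2↔Bool ∘ f)
  = i , j , <⇒≢ i<j , from-injective same
  where
    module B = Inverse 2↔Bool
    from-injective : ∀ {a b} → B.from a ≡ B.from b → a ≡ b
    from-injective {a} {b} eq =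
      trans (sym (B.strictlyInverseˡ a)) (trans (cong B.to eq) (B.strictlyInverseˡ b))

module _ {G : Graph n} where

  adj⇒≢ : adj G u v ≡ true → u ≢ v
  adj⇒≢ {u} uv refl with () ← trans (sym uv) (irrfl G u)

  connected-trans : Connected G u v → Connected G v w → Connected G u w
  connected-trans here        v⇝w = v⇝w
  connected-trans (step e u⇝v) v⇝w = step e (connected-trans u⇝v v⇝w)

  connected-sym : Connected G u v → Connected G v u
  connected-sym here = here
  connected-sym {u} (step {v = u′} e u′⇝v) =
    connected-trans (connected-sym u′⇝v) (step (trans (Graph.sym G u′ u) e) here)

module _ (D : BipartiteTournament n) where

  arc⇒part≢ : arc D u v ≡ true → part D u ≢ part D v
  arc⇒part≢ {u} {v} uv same with () ← trans (sym uv) (inside D u v same)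

  arc-reverse : part D u ≢ part D v → arc D u v ≡ false → arc D v u ≡ true
  arc-reverse {u} {v} u≢v no-uv with across D u v u≢v
  ... | inj₁ uv with () ← trans (sym uv) no-uv
  ... | inj₂ vu = vu

  nicheAdj-sym : NicheAdj D u v → NicheAdj D v u
  nicheAdj-sym (u≢v , w , inj₁ (uw , vw)) = ≢-sym u≢v , w , inj₁ (vw , uw)
  nicheAdj-sym (u≢v , w , inj₂ (wu , wv)) = ≢-sym u≢v , w , inj₂ (wv , wu)

  nicheAdj⇒part≡ : NicheAdj D u v → part D u ≡ part D v
  nicheAdj⇒part≡ (_ , w , inj₁ (uw , vw)) = both≢⇒≡ (arc⇒part≢ uw) (arc⇒part≢ vw)
  nicheAdj⇒part≡ (_ , w , inj₂ (wu , wv)) =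
    both≢⇒≡ (≢-sym (arc⇒part≢ wu)) (≢-sym (arc⇒part≢ wv))

  nicheAdj⇒opposite : NicheAdj D u v → ∃[ w ] part D u ≢ part D w
  nicheAdj⇒opposite (_ , w , inj₁ (uw , _)) = w , arc⇒part≢ uw
  nicheAdj⇒opposite (_ , w , inj₂ (wu , _)) = w , ≢-sym (arc⇒part≢ wu)

  sameArcTo⇒nicheAdj : u ≢ v → part D u ≢ part D w → part D v ≢ part D w →
                       arc D u w ≡ arc D v w → NicheAdj D u v
  sameArcTo⇒nicheAdj {u} {v} {w} u≢v u∦w v∦w same with arc D u w in uw
  ... | true  = u≢v , w , inj₁ (uw , sym same)
  ... | false = u≢v , w , inj₂ (arc-reverse u∦w uw , arc-reverse v∦w (sym same))

  sameArcFrom⇒nicheAdj : u ≢ v → part D w ≢ part D u → part D w ≢ part D v →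
                         arc D w u ≡ arc D w v → NicheAdj D u v
  sameArcFrom⇒nicheAdj {u} {v} {w} u≢v w∦u w∦v same with arc D w u in wu
  ... | true  = u≢v , w , inj₂ (wu , sym same)
  ... | false = u≢v , w , inj₁ (arc-reverse w∦u wu , arc-reverse w∦v (sym same))

module NicheGraph {G : Graph n} {D : BipartiteTournament n} (niche : IsNicheGraphOf G D) where

  nicheAdj⇒connected : NicheAdj D u v → Connected G u v
  nicheAdj⇒connected {u} {v} uv = step (from (niche u v) uv) here

  connected⇒part≡ : Connected G u v → part D u ≡ part D v
  connected⇒part≡ here = refl
  connected⇒part≡ {u} (step {v = u′} e u′⇝v) =
    trans (nicheAdj⇒part≡ D (to (niche u u′) e)) (connected⇒part≡ u′⇝v)

  connected⇒opposite : u ≢ v → Connected G u v → ∃[ w ] part D u ≢ part D w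
  connected⇒opposite u≢u here = ⊥-elim (u≢u refl)
  connected⇒opposite {u} _ (step {v = u′} e _) = nicheAdj⇒opposite D (to (niche u u′) e)

  sameArcTo⇒connected : part D u ≢ part D w → part D v ≢ part D w →
                        arc D u w ≡ arc D v w → Connected G u v
  sameArcTo⇒connected {u} {w} {v} u∦w v∦w same with u ≟ v
  ... | yes refl = here
  ... | no u≢v   = nicheAdj⇒connected (sameArcTo⇒nicheAdj D u≢v u∦w v∦w same)

  sameArcFrom⇒connected : part D w ≢ part D u → part D w ≢ part D v →
                          arc D w u ≡ arc D w v → Connected G u v
  sameArcFrom⇒connected {w} {u} {v} w∦u w∦v same with u ≟ v
  ... | yes refl = here
  ... | no u≢v   = nicheAdj⇒connected (sameArcFrom⇒nicheAdj D u≢v w∦u w∦v same)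

  commonOut⇒connected : arc D u w ≡ true → arc D v w ≡ true → Connected G u v
  commonOut⇒connected uw vw =
    sameArcTo⇒connected (arc⇒part≢ D uw) (arc⇒part≢ D vw) (trans uw (sym vw))

  commonIn⇒connected : arc D w u ≡ true → arc D w v ≡ true → Connected G u v
  commonIn⇒connected wu wv =
    sameArcFrom⇒connected (arc⇒part≢ D wu) (arc⇒part≢ D wv) (trans wu (sym wv))

  module IncompletePair {u v : Fin n} (u≢v : u ≢ v) (u⇝v : Connected G u v)
                        (u≁v : ¬ NicheAdj D u v) where

    pivot : Fin n
    pivot = proj₁ (connected⇒opposite u≢v u⇝v)

    ownPart∦pivot : part D x ≡ part D u → part D x ≢ part D pivot
    ownPart∦pivot x∈X = proj₂ (connected⇒opposite u≢v u⇝v) ∘ trans (sym x∈X)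

    v∈X : part D v ≡ part D u
    v∈X = sym (connected⇒part≡ u⇝v)

    v-disagrees : arc D v pivot ≢ arc D u pivot
    v-disagrees same =
      u≁v (sameArcTo⇒nicheAdj D u≢v (ownPart∦pivot refl) (ownPart∦pivot v∈X) (sym same))

    ownPart-connected : part D x ≡ part D u → Connected G u x
    ownPart-connected {x} x∈X with arc D x pivot Bool.≟ arc D u pivot
    ... | yes agree = sameArcTo⇒connected (ownPart∦pivot refl) (ownPart∦pivot x∈X) (sym agree)
    ... | no differ = connected-trans u⇝v
      (sameArcTo⇒connected (ownPart∦pivot v∈X) (ownPart∦pivot x∈X) (both≢⇒≡ v-disagrees differ))

    otherPart-¬¬connected : part D p ≢ part D u → part D q ≢ part D u → ¬ ¬ Connected G p q
    otherPart-¬¬connected {p} {q} p∉X q∉X p⇝̸q =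
      u≁v (sameArcTo⇒nicheAdj D u≢v (∦p refl) (∦p v∈X) (connected-preserves-arc u⇝v refl))
      where
        ∦p : part D x ≡ part D u → part D x ≢ part D p
        ∦p x∈X = ≢-sym p∉X ∘ trans (sym x∈X)

        ∦q : part D x ≡ part D u → part D x ≢ part D q
        ∦q x∈X = ≢-sym q∉X ∘ trans (sym x∈X)

        arc-to-q : part D x ≡ part D u → arc D x q ≡ not (arc D x p)
        arc-to-q x∈X =
          ¬-not (λ same → p⇝̸q (sameArcFrom⇒connected (∦p x∈X) (∦q x∈X) (sym same)))

        differing-arcs⇒connected : part D x ≡ part D u → part D y ≡ part D u →
                                   NicheAdj D x y → arc D x p ≡ true → arc D y p ≡ false →
                                   Connected G p q
        differing-arcs⇒connected {x} {y} x∈X y∈X (_ , w , inj₁ (xw , yw)) xp no-yp =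
          connected-trans (commonIn⇒connected xp xw) (connected-sym (commonIn⇒connected yq yw))
          where
            yq : arc D y q ≡ true
            yq = trans (arc-to-q y∈X) (cong not no-yp)
        differing-arcs⇒connected {x} {y} x∈X y∈X (_ , w , inj₂ (wx , wy)) xp no-yp =
          connected-trans (commonOut⇒connected (arc-reverse D (∦p y∈X) no-yp) wy)
            (connected-sym (commonOut⇒connected (arc-reverse D (∦q x∈X) no-xq) wx))
          where
            no-xq : arc D x q ≡ false
            no-xq = trans (arc-to-q x∈X) (cong not xp)

        nicheAdj-preserves-arc : part D x ≡ part D u → part D y ≡ part D u →
                                 NicheAdj D x y → arc D x p ≡ arc D y p
        nicheAdj-preserves-arc {x} {y} x∈X y∈X xy with arc D x p in xp | arc D y p in yp
        ... | true  | true  = refl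
        ... | false | false = refl
        ... | true  | false = ⊥-elim (p⇝̸q (differing-arcs⇒connected x∈X y∈X xy xp yp))
        ... | false | true  =
          ⊥-elim (p⇝̸q (differing-arcs⇒connected y∈X x∈X (nicheAdj-sym D xy) yp xp))

        connected-preserves-arc : Connected G x y → part D x ≡ part D u →
                                  arc D x p ≡ arc D y p
        connected-preserves-arc here _ = refl
        connected-preserves-arc {x} (step {v = x′} e x′⇝y) x∈X =
          trans (nicheAdj-preserves-arc x∈X x′∈X xx′) (connected-preserves-arc x′⇝y x′∈X)
          where
            xx′ : NicheAdj D x x′
            xx′ = to (niche x x′) e
            x′∈X : part D x′ ≡ part D u
            x′∈X = trans (sym (nicheAdj⇒part≡ D xx′)) x∈X

    samePart-¬¬connected : part D x ≡ part D y → ¬ ¬ Connected G x y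
    samePart-¬¬connected {x} {y} same with part D x Bool.≟ part D u
    ... | yes x∈X = λ x⇝̸y → x⇝̸y
                      (connected-trans (connected-sym (ownPart-connected x∈X))
                                       (ownPart-connected (trans (sym same) x∈X)))
    ... | no x∉X = otherPart-¬¬connected x∉X (x∉X ∘ trans same)

  threeComponents⇒componentsComplete : (r : Fin 3 → Fin n) →
                                       (∀ {i j} → i ≢ j → ¬ Connected G (r i) (r j)) →
                                       ComponentsComplete G
  threeComponents⇒componentsComplete r separated u v u≢v u⇝v with adj G u v in uv
  ... | true  = refl
  ... | false with i , j , i≢j , same ← bool-pigeonhole (part D ∘ r) =
    ⊥-elim (IncompletePair.samePart-¬¬connected u≢v u⇝v u≁v same (separated i≢j))
    where
      u≁v : ¬ NicheAdj D u v
      u≁v N with () ← trans (sym (from (niche u v) N)) uv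

pullback : (Fin n → Fin m) → BipartiteTournament m → BipartiteTournament n
pullback L D = record
  { part   = part D ∘ L
  ; arc    = λ u v → arc D (L u) (L v)
  ; inside = λ u v → inside D (L u) (L v)
  ; across = λ u v → across D (L u) (L v)
  ; asym   = λ u v → asym D (L u) (L v)
  }

next : Fin 4 → Fin 4
next 0F = 1F
next 1F = 2F
next 2F = 3F
next 3F = 0F

prev : Fin 4 → Fin 4
prev 0F = 3F
prev 1F = 0F
prev 2F = 1F
prev 3F = 2F

prev-next : ∀ a → prev (next a) ≡ a
prev-next 0F = refl
prev-next 1F = refl
prev-next 2F = refl
prev-next 3F = refl

next-injective : ∀ {a b} → next a ≡ next b → a ≡ b
next-injective {a} {b} eq = trans (sym (prev-next a)) (trans (cong prev eq) (prev-next b))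

next²≢id : ∀ a → next (next a) ≢ a
next²≢id 0F ()
next²≢id 1F ()
next²≢id 2F ()
next²≢id 3F ()

parity : Fin 4 → Bool
parity 0F = false
parity 1F = true
parity 2F = false
parity 3F = true

parity-next : ∀ a → parity (next a) ≢ parity a
parity-next 0F ()
parity-next 1F ()
parity-next 2F ()
parity-next 3F ()

next-or-prev : ∀ a b → parity a ≡ not (parity b) → next a ≡ b ⊎ next b ≡ a
next-or-prev 0F 1F _ = inj₁ refl
next-or-prev 0F 3F _ = inj₂ refl
next-or-prev 1F 0F _ = inj₂ refl
next-or-prev 1F 2F _ = inj₁ refl
next-or-prev 2F 1F _ = inj₂ refl
next-or-prev 2F 3F _ = inj₁ refl
next-or-prev 3F 0F _ = inj₁ refl
next-or-prev 3F 2F _ = inj₂ refl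
next-or-prev 0F 0F ()
next-or-prev 0F 2F ()
next-or-prev 1F 1F ()
next-or-prev 1F 3F ()
next-or-prev 2F 0F ()
next-or-prev 2F 2F ()
next-or-prev 3F 1F ()
next-or-prev 3F 3F ()

cycleArc : Fin 4 → Fin 4 → Bool
cycleArc a b = does (next a ≟ b)

cycleArc⇒next : ∀ a {b} → cycleArc a b ≡ true → next a ≡ b
cycleArc⇒next a {b} ab with next a ≟ b
... | yes eq = eq

next⇒cycleArc : ∀ a {b} → next a ≡ b → cycleArc a b ≡ true
next⇒cycleArc a {b} = dec-true (next a ≟ b)

cycle : BipartiteTournament 4
cycle = record
  { part   = parity
  ; arc    = cycleArc
  ; inside = λ a b same → dec-false (next a ≟ b) (λ { refl → parity-next a (sym same) })
  ; across = λ a b a∦b →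
      Sum.map (next⇒cycleArc a) (next⇒cycleArc b) (next-or-prev a b (¬-not a∦b))
  ; asym   = λ a b (ab , ba) →
      next²≢id a (trans (cong next (cycleArc⇒next a ab)) (cycleArc⇒next b ba))
  }

module CycleLabelling (L : Fin n → Fin 4) where

  nicheAdj⇒label≡ : NicheAdj (pullback L cycle) u v → L u ≡ L v
  nicheAdj⇒label≡ {u} {v} (_ , w , inj₁ (uw , vw)) =
    next-injective (trans (cycleArc⇒next (L u) uw) (sym (cycleArc⇒next (L v) vw)))
  nicheAdj⇒label≡ (_ , w , inj₂ (wu , wv)) =
    trans (sym (cycleArc⇒next (L w) wu)) (cycleArc⇒next (L w) wv)

  module _ (x₁ : ∃[ x ] L x ≡ 1F) (x₂ : ∃[ x ] L x ≡ 2F) where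

    commonNeighbour : ∀ a → (∃[ w ] next a ≡ L w) ⊎ (∃[ w ] next (L w) ≡ a)
    commonNeighbour 0F = inj₁ (proj₁ x₁ , sym (proj₂ x₁))
    commonNeighbour 1F = inj₁ (proj₁ x₂ , sym (proj₂ x₂))
    commonNeighbour 2F = inj₂ (proj₁ x₁ , cong next (proj₂ x₁))
    commonNeighbour 3F = inj₂ (proj₁ x₂ , cong next (proj₂ x₂))

    label≡⇒nicheAdj : u ≢ v → L u ≡ L v → NicheAdj (pullback L cycle) u v
    label≡⇒nicheAdj {u} u≢v same with commonNeighbour (L u)
    ... | inj₁ (w , uw) =
      u≢v , w , inj₁ (next⇒cycleArc _ uw , next⇒cycleArc _ (trans (cong next (sym same)) uw))
    ... | inj₂ (w , wu) =
      u≢v , w , inj₂ (next⇒cycleArc _ wu , next⇒cycleArc _ (trans wu same))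

    completeComponents⇒nicheGraph : {G : Graph n} → (∀ u v → L u ≡ L v ⇔ Connected G u v) →
                                    ComponentsComplete G → IsNicheGraphOf G (pullback L cycle)
    completeComponents⇒nicheGraph {G} components complete u v = mk⇔
      (λ uv → label≡⇒nicheAdj (adj⇒≢ {G = G} uv) (from (components u v) (step uv here)))
      (λ uv → complete u v (proj₁ uv) (to (components u v) (nicheAdj⇒label≡ uv)))

record ComponentLabelling (G : Graph n) : Set where
  field
    label                : Fin n → Fin 4
    label≡⇔connected     : ∀ u v → label u ≡ label v ⇔ Connected G u v
    representative       : Fin 3 → Fin n
    label-representative : ∀ i → label (representative i) ≡ inject₁ i

  representatives-disconnected : ∀ {i j} → i ≢ j →
                                 ¬ Connected G (representative i) (representative j)
  representatives-disconnected {i} {j} i≢j i⇝j =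
    i≢j (inject₁-injective (begin
      inject₁ i                   ≡⟨ label-representative i ⟨
      label (representative i)    ≡⟨ from (label≡⇔connected _ _) i⇝j ⟩
      label (representative j)    ≡⟨ label-representative j ⟩
      inject₁ j                   ∎))
    where open ≡-Reasoning

threeOrFourComponents⇒labelling : {G : Graph n} → HasComponents G 3 ⊎ HasComponents G 4 →
                                  ComponentLabelling G
threeOrFourComponents⇒labelling (inj₁ (c , surjective , components)) = record
  { label                = inject₁ ∘ c
  ; label≡⇔connected     = λ u v →
      mk⇔ (to (components u v) ∘ inject₁-injective) (cong inject₁ ∘ from (components u v))
  ; representative       = λ i → proj₁ (surjective i)
  ; label-representative = λ i → cong inject₁ (proj₂ (surjective i) refl)
  }
threeOrFourComponents⇒labelling (inj₂ (c , surjective , components)) = record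
  { label                = c
  ; label≡⇔connected     = components
  ; representative       = λ i → proj₁ (surjective (inject₁ i))
  ; label-representative = λ i → proj₂ (surjective (inject₁ i)) refl
  }

theorem3p4 : (n : ℕ) (G : Graph n) →
    HasComponents G 3 ⊎ HasComponents G 4 →
    NicheRealizable G ⇔ ComponentsComplete G
theorem3p4 n G components = mk⇔
  (λ { (D , niche) → NicheGraph.threeComponents⇒componentsComplete {G = G} {D = D} niche
                        representative representatives-disconnected })
  (λ complete → pullback label cycle ,
     CycleLabelling.completeComponents⇒nicheGraph label
       (representative 1F , label-representative 1F) (representative 2F , label-representative 2F)
       label≡⇔connected complete)
  where open ComponentLabelling (threeOrFourComponents⇒labelling {G = G} components)
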